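{- Let $G$ be a finite simple graph, let $uv$ be an edge of $G$, and let $w$ be a vertex distinct from $u$ and $v$. Then $w$ is a pendant vertex on $u$ in $G$ if and only if $w$ is a false twin of $v$ in $G^{uv}$. Moreover, $u$ and $v$ are true twins in $G$ if and only if $u$ and $v$ are true twins in $G^{uv}$.
   Context: Pivot: for an edge $uv$ of $G$, let $A_u$, $A_v$, $A_{uv}$ be the sets of vertices other than $u,v$ adjacent to $u$ only, to $v$ only, and to both $u$ and $v$, respectively. $G^{uv}$ has the same vertex set as $G$ and edge set equal to the symmetric difference of $E(G)$ with the edge set of the complete tripartite graph with vertex classes $A_u,A_v,A_{uv}$. $w$ is pendant on $u$ if the only neighbor of $w$ is $u$. Two distinct vertices $a,b$ are false twins if they are non-adjacent and have the same neighborhood; they are true twins if they are adjacent and $N(a)\setminus\{b\}=N(b)\setminus\{a\}$. -}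

module Defs where

open import Data.Nat using (ℕ)
open import Data.Fin using (Fin)
open import Data.Fin.Properties using (_≟_)
open import Data.Bool using (Bool; true; false; _∧_; _∨_; _xor_; not; if_then_else_)
open import Relation.Nullary using (¬_)
open import Relation.Nullary.Decidable using (⌊_⌋)
open import Relation.Binary.PropositionalEquality using (_≡_; _≢_)
open import Data.Product using (_×_)

record Graph (n : ℕ) : Set where
  field
    adj   : Fin n → Fin n → Bool
    sym   : ∀ x y → adj x y ≡ adj y x
    irrefl : ∀ x → adj x x ≡ false

open Graph public

Adj : ∀ {n} → Graph n → Fin n → Fin n → Set
Adj G x y = adj G x y ≡ true

notIn : ∀ {n} → Fin n → Fin n → Fin n → Bool
notIn a b x = not ⌊ x ≟ a ⌋ ∧ not ⌊ x ≟ b ⌋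

_≠ᵇ_ : Bool → Bool → Bool
a ≠ᵇ b = a xor b

-- Edge relation of the complete tripartite graph with classes
-- A_u (adjacent to u only), A_v (adjacent to v only), A_uv (adjacent to both),
-- all taken among vertices other than u, v.  x and y are in some class iff
-- they are outside {u,v} and adjacent to u or v; the class is determined by
-- the pair (adj u x, adj v x); x,y are joined iff the classes differ.
tripartite : ∀ {n} → Graph n → Fin n → Fin n → Fin n → Fin n → Bool
tripartite G u v x y =
  notIn u v x ∧ notIn u v y
  ∧ (adj G u x ∨ adj G v x) ∧ (adj G u y ∨ adj G v y)
  ∧ ((adj G u x ≠ᵇ adj G u y) ∨ (adj G v x ≠ᵇ adj G v y))

pivotAdj : ∀ {n} → Graph n → Fin n → Fin n → Fin n → Fin n → Bool
pivotAdj G u v x y = adj G x y xor tripartite G u v x y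

-- Propositional notions, phrased over an arbitrary adjacency function
-- so they apply both to G and to G^{uv}.
Rel : ℕ → Set
Rel n = Fin n → Fin n → Bool

Pendant : ∀ {n} → Rel n → Fin n → Fin n → Set
Pendant A w u = A w u ≡ true × (∀ z → A w z ≡ true → z ≡ u)

FalseTwins : ∀ {n} → Rel n → Fin n → Fin n → Set
FalseTwins A a b = a ≢ b × A a b ≡ false × (∀ z → A a z ≡ A b z)

TrueTwins : ∀ {n} → Rel n → Fin n → Fin n → Set
TrueTwins A a b = a ≢ b × A a b ≡ true
  × (∀ z → z ≢ a → z ≢ b → A a z ≡ A b z)

-- Pivoting on uv only toggles pairs of vertices that both lie outside {u, v},
-- so every adjacency involving u or v is the same in G and G^{uv}; this alone
-- gives the statement about u, v being true twins. A vertex w pendant on u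
-- lies in A_u, and in G^{uv} it gains an edge to exactly the vertices of
-- A_v ∪ A_uv, i.e. to N(v) \ {u, v}; together with the untouched edge wu this
-- makes N^{uv}(w) = N^{uv}(v). Conversely a false twin w of v in G^{uv} is
-- adjacent to u and not to v, so again lies in A_u, and then any further
-- neighbour z of w in G would make w and v disagree at z in G^{uv}.
module Submission where

open import Defs
open import Data.Fin using (Fin)
open import Data.Fin.Properties using (_≟_)
open import Data.Bool using (true; false; _xor_)
open import Data.Bool.Properties using (xor-identityʳ; ∧-zeroʳ)
open import Data.Product using (_×_; _,_)
open import Data.Empty using (⊥-elim)
open import Relation.Nullary using (Dec; yes; no)
open import Function.Bundles using (_⇔_; mk⇔)
open import Relation.Binary.PropositionalEquality as ≡
  using (_≡_; _≢_; refl; trans; cong)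

xor-cancelˡ : ∀ a b → a xor b ≡ b → a ≡ false
xor-cancelˡ false _     _  = refl
xor-cancelˡ true  false ()
xor-cancelˡ true  true  ()

Pendant-nonadjacent : ∀ {n} {A : Rel n} {w u z} →
  Pendant A w u → z ≢ u → A w z ≡ false
Pendant-nonadjacent {A = A} {w} {z = z} (_ , only) z≢u with A w z in wz
... | false = refl
... | true  = ⊥-elim (z≢u (only z wz))

TrueTwins-transport : ∀ {n} {A B : Rel n} {a b} →
  (∀ z → A a z ≡ B a z) → (∀ z → A b z ≡ B b z) →
  TrueTwins A a b → TrueTwins B a b
TrueTwins-transport ra rb (a≢b , ab , same) =
  a≢b , trans (≡.sym (ra _)) ab ,
  λ z z≢a z≢b → trans (≡.sym (ra z)) (trans (same z z≢a z≢b) (rb z))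

TrueTwins-cong : ∀ {n} {A B : Rel n} {a b} →
  (∀ z → A a z ≡ B a z) → (∀ z → A b z ≡ B b z) →
  TrueTwins A a b ⇔ TrueTwins B a b
TrueTwins-cong ra rb = mk⇔ (TrueTwins-transport ra rb)
  (TrueTwins-transport (λ z → ≡.sym (ra z)) (λ z → ≡.sym (rb z)))

module _ {n} (G : Graph n) (u v : Fin n) where

  notIn-left : notIn u v u ≡ false
  notIn-left with u ≟ u
  ... | yes _   = refl
  ... | no u≢u = ⊥-elim (u≢u refl)

  notIn-right : notIn u v v ≡ false
  notIn-right with v ≟ u | v ≟ v
  ... | yes _ | _       = refl
  ... | no _  | yes _   = refl
  ... | no _  | no v≢v = ⊥-elim (v≢v refl)

  notIn-outside : ∀ {x} → x ≢ u → x ≢ v → notIn u v x ≡ true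
  notIn-outside {x} x≢u x≢v with x ≟ u | x ≟ v
  ... | yes x≡u | _       = ⊥-elim (x≢u x≡u)
  ... | no _    | yes x≡v = ⊥-elim (x≢v x≡v)
  ... | no _    | no _    = refl

  pivotAdj-unchangedˡ : ∀ {x} z → notIn u v x ≡ false → pivotAdj G u v x z ≡ adj G x z
  pivotAdj-unchangedˡ z x∈uv rewrite x∈uv = xor-identityʳ _

  pivotAdj-unchangedʳ : ∀ x {z} → notIn u v z ≡ false → pivotAdj G u v x z ≡ adj G x z
  pivotAdj-unchangedʳ x z∈uv rewrite z∈uv | ∧-zeroʳ (notIn u v x) = xor-identityʳ _

  tripartite-Aᵤ : ∀ {w z} → adj G w u ≡ true → adj G w v ≡ false →
    w ≢ u → w ≢ v → z ≢ u → z ≢ v → tripartite G u v w z ≡ adj G v z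
  tripartite-Aᵤ {w} {z} wu wv w≢u w≢v z≢u z≢v
    rewrite Graph.sym G u w | wu | Graph.sym G v w | wv | notIn-outside w≢u w≢v | notIn-outside z≢u z≢v
    with adj G u z | adj G v z
  ... | true  | true  = refl
  ... | true  | false = refl
  ... | false | true  = refl
  ... | false | false = refl

  pivotAdj-trueTwins : TrueTwins (adj G) u v ⇔ TrueTwins (pivotAdj G u v) u v
  pivotAdj-trueTwins = TrueTwins-cong {B = pivotAdj G u v}
    (λ z → ≡.sym (pivotAdj-unchangedˡ z notIn-left))
    (λ z → ≡.sym (pivotAdj-unchangedˡ z notIn-right))

  module _ (uv : Adj G u v) where

    vu : adj G v u ≡ true
    vu = trans (Graph.sym G v u) uv

    u≢v : u ≢ v
    u≢v refl with trans (≡.sym uv) (Graph.irrefl G u)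
    ... | ()

    pendant⇒falseTwins : ∀ {w} → w ≢ u → w ≢ v →
      Pendant (adj G) w u → FalseTwins (pivotAdj G u v) w v
    pendant⇒falseTwins {w} w≢u w≢v pendant@(wu , _) =
      w≢v , trans (pivotAdj-unchangedʳ w notIn-right) wv , same
      where
      open ≡.≡-Reasoning
      nonadjacent : ∀ {z} → z ≢ u → adj G w z ≡ false
      nonadjacent = Pendant-nonadjacent {A = adj G} pendant

      wv : adj G w v ≡ false
      wv = nonadjacent (λ v≡u → u≢v (≡.sym v≡u))

      same : ∀ z → pivotAdj G u v w z ≡ pivotAdj G u v v z
      same z = same-at (z ≟ u) (z ≟ v)
        where
        same-at : Dec (z ≡ u) → Dec (z ≡ v) → pivotAdj G u v w z ≡ pivotAdj G u v v z
        same-at (yes refl) _ = begin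
          pivotAdj G u v w u  ≡⟨ pivotAdj-unchangedʳ w notIn-left ⟩
          adj G w u           ≡⟨ trans wu (≡.sym vu) ⟩
          adj G v u           ≡⟨ ≡.sym (pivotAdj-unchangedˡ u notIn-right) ⟩
          pivotAdj G u v v u  ∎
        same-at (no _) (yes refl) = begin
          pivotAdj G u v w v  ≡⟨ pivotAdj-unchangedʳ w notIn-right ⟩
          adj G w v           ≡⟨ trans wv (≡.sym (Graph.irrefl G v)) ⟩
          adj G v v           ≡⟨ ≡.sym (pivotAdj-unchangedˡ v notIn-right) ⟩
          pivotAdj G u v v v  ∎
        same-at (no z≢u) (no z≢v) = begin
          adj G w z xor tripartite G u v w z
            ≡⟨ cong (_xor tripartite G u v w z) (nonadjacent z≢u) ⟩
          tripartite G u v w z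
            ≡⟨ tripartite-Aᵤ wu wv w≢u w≢v z≢u z≢v ⟩
          adj G v z
            ≡⟨ ≡.sym (pivotAdj-unchangedˡ z notIn-right) ⟩
          pivotAdj G u v v z  ∎

    falseTwins⇒pendant : ∀ {w} → w ≢ u → w ≢ v →
      FalseTwins (pivotAdj G u v) w v → Pendant (adj G) w u
    falseTwins⇒pendant {w} w≢u w≢v (_ , pwv , same) = wu , only
      where
      open ≡.≡-Reasoning
      wv : adj G w v ≡ false
      wv = trans (≡.sym (pivotAdj-unchangedʳ w notIn-right)) pwv

      wu : adj G w u ≡ true
      wu = begin
        adj G w u           ≡⟨ ≡.sym (pivotAdj-unchangedʳ w notIn-left) ⟩
        pivotAdj G u v w u  ≡⟨ same u ⟩
        pivotAdj G u v v u  ≡⟨ pivotAdj-unchangedˡ u notIn-right ⟩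
        adj G v u           ≡⟨ vu ⟩
        true                ∎

      only : ∀ z → adj G w z ≡ true → z ≡ u
      only z wz = only-at (z ≟ u) (z ≟ v)
        where
        only-at : Dec (z ≡ u) → Dec (z ≡ v) → z ≡ u
        only-at (yes z≡u) _ = z≡u
        only-at (no _) (yes refl) with trans (≡.sym wz) wv
        ... | ()
        only-at (no z≢u) (no z≢v) with trans (≡.sym wz) (xor-cancelˡ _ _ toggled)
          where
          toggled : adj G w z xor adj G v z ≡ adj G v z
          toggled = begin
            adj G w z xor adj G v z
              ≡⟨ cong (adj G w z xor_) (≡.sym (tripartite-Aᵤ wu wv w≢u w≢v z≢u z≢v)) ⟩
            pivotAdj G u v w z  ≡⟨ same z ⟩
            pivotAdj G u v v z  ≡⟨ pivotAdj-unchangedˡ z notIn-right ⟩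
            adj G v z           ∎
        ... | ()

    pendant⇔falseTwins : ∀ {w} → w ≢ u → w ≢ v →
      Pendant (adj G) w u ⇔ FalseTwins (pivotAdj G u v) w v
    pendant⇔falseTwins w≢u w≢v =
      mk⇔ (pendant⇒falseTwins w≢u w≢v) (falseTwins⇒pendant w≢u w≢v)

proposition4p10 : ∀ {n} (G : Graph n) (u v : Fin n) → Adj G u v →
    ((w : Fin n) → w ≢ u → w ≢ v →
      Pendant (adj G) w u ⇔ FalseTwins (pivotAdj G u v) w v)
    × (TrueTwins (adj G) u v ⇔ TrueTwins (pivotAdj G u v) u v)
proposition4p10 G u v uv =
  (λ _ → pendant⇔falseTwins G u v uv) , pivotAdj-trueTwins G u v
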